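{- Let $A = (\Sigma_I \times \Sigma_O, Q, \delta, q_0, F)$ be a nondeterministic Büchi automaton (every state and transition lying on an accepting run), where $\Sigma_I = 2^I$, $\Sigma_O = 2^O$, let $X \subseteq O$, and write letters as triples $(\sigma_I, \sigma, \sigma') \in \Sigma_I \times \Sigma_{O\setminus X} \times \Sigma_X$. Define on subsets of $Q$ the transition function $\delta^X(U,(\sigma_I,\sigma)) = \{q' \in Q \mid \exists q \in U\ \exists \sigma' \in \Sigma_X : q' \in \delta(q,(\sigma_I,\sigma,\sigma'))\}$ for $U \subseteq Q$ and $(\sigma_I,\sigma) \in \Sigma_I \times \Sigma_{O \setminus X}$. If $X$ is automata dependent on $V \setminus X$ in $A$ (where $V = I \cup O$), then every set $U$ reachable from $\{q_0\}$ by finitely many applications of $\delta^X$ satisfies: for all $q, q' \in U$, the pair $(q,q')$ is compatible in $A$.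
   Context: $\Sigma_Z = 2^Z$ is the set of assignments to $Z$. For a letter $a$ and $Z \subseteq V$, $a.Z$ is the restriction of $a$ to $Z$. A pair $(s,s')$ of states is compatible in $A$ if there is a finite word with runs from $q_0$ to $s$ and from $q_0$ to $s'$ both reading it. $X$ is automata dependent on $Y$ in $A$ if for every compatible pair $(s,s')$ and letters $\sigma,\sigma'$ with $\sigma.Y = \sigma'.Y$ and $\sigma.X \neq \sigma'.X$, not both $\delta(s,\sigma) \ne \emptyset$ and $\delta(s',\sigma') \ne \emptyset$. -}

module Defs where

open import Data.Nat using (ℕ; suc; _≤_)
open import Data.Fin using (Fin)
open import Data.Bool using (Bool; true; false)
open import Data.Vec using (Vec; lookup)
open import Data.List using (List; []; _∷_)
open import Data.Product using (Σ; ∃; _×_; _,_)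
open import Relation.Binary.PropositionalEquality using (_≡_)
open import Relation.Nullary using (¬_)

-- Variables V = Fin n.  A letter is an assignment V → Bool, given as a vector
-- (an element of 2^V = Σ_I × Σ_O).
Letter : ℕ → Set
Letter n = Vec Bool n

_≡on_by_ : ∀ {n} → Letter n → Letter n → (Fin n → Bool) → Set
_≡on_by_ {n} σ σ' Z = ∀ (v : Fin n) → Z v ≡ true → lookup σ v ≡ lookup σ' v

∁ : ∀ {n} → (Fin n → Bool) → (Fin n → Bool)
∁ Z v with Z v
... | true = false
... | false = true

record NBA (n m : ℕ) : Set₁ where
  field
    δ  : Fin m → Letter n → Fin m → Set
    q₀ : Fin m
    F  : Fin m → Set
open NBA public

module _ {n m : ℕ} (A : NBA n m) where

  record AcceptingRun : Set where
    field
      word : ℕ → Letter n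
      run  : ℕ → Fin m
      start : run 0 ≡ q₀ A
      step  : ∀ i → δ A (run i) (word i) (run (suc i))
      buchi : ∀ k → Σ ℕ λ j → (k ≤ j) × F A (run j)
  open AcceptingRun public

  AllOnAcceptingRuns : Set
  AllOnAcceptingRuns =
    (∀ q → Σ AcceptingRun λ r → Σ ℕ λ i → run r i ≡ q)
    × (∀ q σ q' → δ A q σ q' →
         Σ AcceptingRun λ r → Σ ℕ λ i →
           (run r i ≡ q) × (word r i ≡ σ) × (run r (suc i) ≡ q'))

  data Path : Fin m → List (Letter n) → Fin m → Set where
    nil  : ∀ {q} → Path q [] q
    cons : ∀ {q q' q'' σ w} → δ A q σ q' → Path q' w q'' → Path q (σ ∷ w) q''

  Compatible : Fin m → Fin m → Set
  Compatible s s' = Σ (List (Letter n)) λ w → Path (q₀ A) w s × Path (q₀ A) w s'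

  NonEmpty : Fin m → Letter n → Set
  NonEmpty s σ = ∃ λ q' → δ A s σ q'

  AutomataDependent : (X Y : Fin n → Bool) → Set
  AutomataDependent X Y = ∀ s s' σ σ' → Compatible s s' →
    σ ≡on σ' by Y → ¬ (σ ≡on σ' by X) → ¬ (NonEmpty s σ × NonEmpty s' σ')

  -- The argument (σ_I,σ) ∈ Σ_I × Σ_{O∖X} is represented by
  -- a full letter τ whose X-part is ignored; the triple (σ_I,σ,σ') is the letter ρ
  -- agreeing with τ on V∖X and with σ' on X.
  δX : (X : Fin n → Bool) → (Fin m → Set) → Letter n → (Fin m → Set)
  δX X U τ q' = Σ (Fin m) λ q → U q × Σ (Letter n) λ ρ → (ρ ≡on τ by ∁ X) × δ A q ρ q'

  δX* : (X : Fin n → Bool) → (Fin m → Set) → List (Letter n) → (Fin m → Set)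
  δX* X U [] = U
  δX* X U (τ ∷ w) = δX* X (δX X U τ) w

  Singleton₀ : Fin m → Set
  Singleton₀ q = q ≡ q₀ A

{-# OPTIONS --safe #-}
module Submission where

open import Defs
open import Data.Nat using (ℕ)
open import Data.Fin using (Fin)
open import Data.Bool using (Bool; true; false)
open import Data.Bool.Properties using () renaming (_≟_ to _≟ᵇ_)
open import Data.List using (List; []; _∷_; _++_; [_])
open import Data.Vec using (lookup)
open import Data.Vec.Properties using (≡-dec)
open import Data.Vec.Relation.Binary.Pointwise.Extensional using (ext; Pointwise-≡⇒≡)
open import Data.Product using (_,_)
open import Data.Empty using (⊥-elim)
open import Relation.Nullary using (yes; no)
open import Relation.Binary.PropositionalEquality using (_≡_; refl; sym; trans)

-- The property "all members are pairwise compatible" holds for {q₀} and is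
-- preserved by δ^X.  If q₁ ∈ δ^X(U,τ) via a transition on ρ from p and q₂ via ρ' from p',
-- then ρ and ρ' agree with τ off X, and (p, p') is compatible, so automata dependence
-- forces them to agree on X as well; thus ρ = ρ' and the common word extended by ρ
-- witnesses compatibility of (q₁, q₂).

module _ {n : ℕ} where

  ∁-false : ∀ (Z : Fin n → Bool) v → Z v ≡ false → ∁ Z v ≡ true
  ∁-false Z v Zv≡false rewrite Zv≡false = refl

  ≡on-∁⇒≡ : ∀ {a b : Letter n} Z → a ≡on b by Z → a ≡on b by ∁ Z → a ≡ b
  ≡on-∁⇒≡ {a} {b} Z on-Z on-∁Z = Pointwise-≡⇒≡ (ext agree)
    where
    agree : ∀ v → lookup a v ≡ lookup b v
    agree v with Z v in Zv
    ... | true  = on-Z v Zv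
    ... | false = on-∁Z v (∁-false Z v Zv)

module _ {n m : ℕ} (A : NBA n m) where

  Path-snoc : ∀ {q q' q'' σ} {u : List (Letter n)} →
              Path A q u q' → δ A q' σ q'' → Path A q (u ++ [ σ ]) q''
  Path-snoc nil        d = cons d nil
  Path-snoc (cons e p) d = cons e (Path-snoc p d)

  Compatible-step : ∀ {s s' t t' σ} → Compatible A s s' →
                    δ A s σ t → δ A s' σ t' → Compatible A t t'
  Compatible-step {σ = σ} (u , p , p') d d' = u ++ [ σ ] , Path-snoc p d , Path-snoc p' d'

  PairwiseCompatible : (Fin m → Set) → Set
  PairwiseCompatible U = ∀ q q' → U q → U q' → Compatible A q q'

  Singleton₀-pairwiseCompatible : PairwiseCompatible (Singleton₀ A)
  Singleton₀-pairwiseCompatible _ _ refl refl = [] , nil , nil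

  module _ (X : Fin n → Bool) (dep : AutomataDependent A X (∁ X)) where

    δX-pairwiseCompatible : ∀ {U} τ → PairwiseCompatible U → PairwiseCompatible (δX A X U τ)
    δX-pairwiseCompatible τ compat q q' (p , Up , ρ , ρ≈τ , d) (p' , Up' , ρ' , ρ'≈τ , d')
      with ≡-dec _≟ᵇ_ ρ ρ'
    ... | yes refl = Compatible-step (compat p p' Up Up') d d'
    ... | no ρ≢ρ' = ⊥-elim (dep p p' ρ ρ' (compat p p' Up Up') ρ≈ρ'
                                 (λ ρ≈ρ'-on-X → ρ≢ρ' (≡on-∁⇒≡ X ρ≈ρ'-on-X ρ≈ρ'))
                                 ((q , d) , (q' , d')))
      where
      ρ≈ρ' : ρ ≡on ρ' by ∁ X
      ρ≈ρ' v ∁Xv = trans (ρ≈τ v ∁Xv) (sym (ρ'≈τ v ∁Xv))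

    δX*-pairwiseCompatible : ∀ {U} w → PairwiseCompatible U → PairwiseCompatible (δX* A X U w)
    δX*-pairwiseCompatible []      compat = compat
    δX*-pairwiseCompatible (τ ∷ w) compat =
      δX*-pairwiseCompatible w (δX-pairwiseCompatible τ compat)

lemma2 : ∀ {n m : ℕ} (A : NBA n m) (isI : Fin n → Bool) (X : Fin n → Bool) →
    AllOnAcceptingRuns A →
    (∀ v → X v ≡ true → isI v ≡ false) →
    AutomataDependent A X (∁ X) →
    ∀ (w : List (Letter n)) (q q' : Fin m) →
    δX* A X (Singleton₀ A) w q → δX* A X (Singleton₀ A) w q' →
    Compatible A q q'
lemma2 A _ X _ _ dep w =
  δX*-pairwiseCompatible A X dep w (Singleton₀-pairwiseCompatible A)
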